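{- Let $n\ge 4$ be an integer and let $\mathcal{Q}(n)$ be the $n$-Queens' graph. Then: 1. $-4$ is an eigenvalue of $\mathcal{Q}(n)$ if and only if there exists a vector $X=(x_{(i,j)})_{(i,j)\in[n]^2}\in\mathbb{R}^{n^2}\setminus\{\mathbf{0}\}$ such that (a) $\sum_{j=1}^n x_{(k,j)}=0$ and $\sum_{i=1}^n x_{(i,k)}=0$ for every $k\in[n]$; (b) $\sum_{i+j=k+2} x_{(i,j)}=0$ for every $k\in[2n-3]$; (c) $\sum_{i-j=k+1-n} x_{(i,j)}=0$ for every $k\in[2n-3]$; (d) $x_{(1,1)}=x_{(1,n)}=x_{(n,1)}=x_{(n,n)}=0$, where the sums range over $(i,j)\in[n]^2$. In the positive case, any such $X$ is an eigenvector associated with the eigenvalue $-4$. 2. The least eigenvalue of $\mathcal{Q}(n)$ is $-4$.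
   Context: $[n]=\{1,\dots,n\}$. The $n$-Queens' graph $\mathcal{Q}(n)$ has vertex set $[n]^2$ (the squares of an $n\times n$ chessboard, $(i,j)$ being row $i$, column $j$), and two distinct vertices $(i,j),(i',j')$ are adjacent if and only if $i=i'$, or $j=j'$, or $i+j=i'+j'$, or $i-j=i'-j'$. Eigenvalues are those of the adjacency matrix. -}

module Defs where

open import Level using (0ℓ)
open import Algebra.Bundles using (CommutativeRing)
open import Data.Nat as ℕ using (ℕ; zero; suc)
open import Data.Fin using (Fin; toℕ)
open import Data.Bool using (Bool; true; false; if_then_else_; _∨_; _∧_; not)
open import Data.Product using (Σ; ∃; _×_; _,_)
open import Data.Sum using (_⊎_)
open import Relation.Nullary using (¬_)
open import Relation.Nullary.Decidable using (⌊_⌋)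
open import Relation.Binary.PropositionalEquality using (_≡_)

-- An axiomatic model of the real numbers: a complete ordered field.
-- (agda-stdlib has no reals; ℝ is the unique such structure up to iso.)

record RealField : Set₁ where
  field
    commRing : CommutativeRing 0ℓ 0ℓ
  open CommutativeRing commRing public
  field
    _≤_       : Carrier → Carrier → Set
    0≉1       : ¬ (0# ≈ 1#)
    inverse   : ∀ x → ¬ (x ≈ 0#) → ∃ λ y → x * y ≈ 1#
    ≤-resp-≈  : ∀ {x x' y y'} → x ≈ x' → y ≈ y' → x ≤ y → x' ≤ y'
    ≤-refl    : ∀ {x} → x ≤ x
    ≤-trans   : ∀ {x y z} → x ≤ y → y ≤ z → x ≤ z
    ≤-antisym : ∀ {x y} → x ≤ y → y ≤ x → x ≈ y
    ≤-total   : ∀ x y → (x ≤ y) ⊎ (y ≤ x)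
    +-mono-≤  : ∀ {x y} z → x ≤ y → (x + z) ≤ (y + z)
    *-nonneg  : ∀ {x y} → 0# ≤ x → 0# ≤ y → 0# ≤ (x * y)
    complete  : (P : Carrier → Set) → ∃ P →
                (∃ λ b → ∀ x → P x → x ≤ b) →
                ∃ λ s → (∀ x → P x → x ≤ s) ×
                        (∀ b → (∀ x → P x → x ≤ b) → s ≤ b)

module _ (R : RealField) where
  open RealField R

  four : Carrier
  four = 1# + 1# + 1# + 1#

  minus4 : Carrier
  minus4 = - four

  ΣFin : ∀ n → (Fin n → Carrier) → Carrier
  ΣFin zero    f = 0#
  ΣFin (suc n) f = f Fin.zero + ΣFin n (λ i → f (Fin.suc i))

  -- vectors in ℝ^{n²}, indexed by squares (i , j) (0-indexed rows/cols)
  Vector : ℕ → Set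
  Vector n = Fin n → Fin n → Carrier

  sumWhere : ∀ n → (Fin n → Fin n → Bool) → Vector n → Carrier
  sumWhere n c x = ΣFin n λ i → ΣFin n λ j → if c i j then x i j else 0#

  IsZeroVec : ∀ {n} → Vector n → Set
  IsZeroVec {n} x = ∀ i j → x i j ≈ 0#

  _·_ : ∀ {n} → (Fin n → Fin n → Fin n → Fin n → Carrier) → Vector n → Vector n
  _·_ {n} M x i j = ΣFin n λ k → ΣFin n λ l → M i j k l * x k l

  IsEigenvector : ∀ {n} → (Fin n → Fin n → Fin n → Fin n → Carrier) →
                  Carrier → Vector n → Set
  IsEigenvector {n} M λ' x = ¬ IsZeroVec x × (∀ i j → (M · x) i j ≈ λ' * x i j)

  IsEigenvalue : ∀ {n} → (Fin n → Fin n → Fin n → Fin n → Carrier) → Carrier → Set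
  IsEigenvalue {n} M λ' = ∃ λ (x : Vector n) → IsEigenvector M λ' x

  IsLeastEigenvalue : ∀ {n} → (Fin n → Fin n → Fin n → Fin n → Carrier) → Carrier → Set
  IsLeastEigenvalue M μ = IsEigenvalue M μ × (∀ λ' → IsEigenvalue M λ' → μ ≤ λ')

-- Squares are (i , j) : Fin n × Fin n; the paper's
-- square (i+1 , j+1).  Adjacent iff distinct and same row, same column,
-- same i+j, or same i-j (i - j = i' - j'  ⇔  i + j' = i' + j).

_=ℕ_ : ℕ → ℕ → Bool
a =ℕ b = ⌊ a ℕ.≟ b ⌋

queensAdj : ∀ {n} → Fin n → Fin n → Fin n → Fin n → Bool
queensAdj i j i' j' =
  not (toℕ i =ℕ toℕ i' ∧ toℕ j =ℕ toℕ j') ∧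
  (toℕ i =ℕ toℕ i' ∨ toℕ j =ℕ toℕ j' ∨
   (toℕ i ℕ.+ toℕ j) =ℕ (toℕ i' ℕ.+ toℕ j') ∨
   (toℕ i ℕ.+ toℕ j') =ℕ (toℕ i' ℕ.+ toℕ j))

module _ (R : RealField) where
  open RealField R

  queensMatrix : ∀ n → Fin n → Fin n → Fin n → Fin n → Carrier
  queensMatrix n i j i' j' = if queensAdj i j i' j' then 1# else 0#

  -- conditions (a)–(d) of Theorem 4.1, translated to 0-indexing:
  --  (a) row k and column k sums vanish;
  --  (b) paper i+j = k+2 (1-indexed) ⇔ i0 + j0 = k, for 1 ≤ k ≤ 2n-3;
  --  (c) paper i-j = k+1-n ⇔ i0 + n = j0 + k + 1, for 1 ≤ k ≤ 2n-3;
  --  (d) the four corners vanish.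
  QueensConditions : ∀ n → Vector R n → Set
  QueensConditions n x =
    (∀ (k : Fin n) → sumWhere R n (λ i j → toℕ i =ℕ toℕ k) x ≈ 0#) ×
    (∀ (k : Fin n) → sumWhere R n (λ i j → toℕ j =ℕ toℕ k) x ≈ 0#) ×
    (∀ (k : ℕ) → 1 ℕ.≤ k → k ℕ.≤ 2 ℕ.* n ℕ.∸ 3 →
       sumWhere R n (λ i j → (toℕ i ℕ.+ toℕ j) =ℕ k) x ≈ 0#) ×
    (∀ (k : ℕ) → 1 ℕ.≤ k → k ℕ.≤ 2 ℕ.* n ℕ.∸ 3 →
       sumWhere R n (λ i j → (toℕ i ℕ.+ n) =ℕ (toℕ j ℕ.+ k ℕ.+ 1)) x ≈ 0#) ×
    (∀ i j → (toℕ i ≡ 0 ⊎ toℕ i ≡ n ℕ.∸ 1) → (toℕ j ≡ 0 ⊎ toℕ j ≡ n ℕ.∸ 1) →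
       x i j ≈ 0#)

-- The adjacency matrix A of Q(n) plus 4I splits as R + C + D + E, where R has entry 1 exactly when
-- two squares share a row, and C, D, E do the same for columns, diagonals and antidiagonals: a pair of
-- distinct squares shares at most one line, and a square lies on one line of each of the four kinds.
-- Each summand is a Gram matrix (x·Rx is the sum of the squares of the row sums of x, and so on), so
-- A + 4I is positive semidefinite and no eigenvalue is below -4. If every line sum of x vanishes then
-- (A + 4I)x = 0; conditions (a)-(d) say exactly this, the diagonals and antidiagonals left out of
-- (b) and (c) being single corners. The difference of the two solutions of the 4-queens problem,
-- placed in a corner of the board, has all line sums zero, so -4 is attained.
{-# OPTIONS --safe #-}
module Submission where

open import Defs
open import Data.Nat using (ℕ; _≤_)
open import Data.Product using (_×_; ∃)
open import Function.Bundles using (_⇔_)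
open import Relation.Nullary using (¬_)

import Algebra.Properties.CommutativeSemigroup as CommutativeSemigroupProperties
import Algebra.Properties.Ring as RingProperties
import Algebra.Properties.Semiring.Sum as SemiringSum
import Algebra.Solver.Ring.NaturalCoefficients.Default as NaturalSolver
open import Data.Bool using (Bool; true; false; T; if_then_else_; not; _∧_; _∨_)
open import Data.Bool.Properties using (∧-zeroʳ)
open import Data.Empty using (⊥-elim)
open import Data.Fin using (Fin; zero; suc; toℕ; fromℕ<; opposite; #_)
import Data.Fin.Properties as Finₚ
open import Data.Nat as ℕ using (zero; suc; _<_; z≤n; s≤s)
import Data.Nat.Properties as ℕₚ
open import Data.Nat.Tactic.RingSolver using (solve-∀)
open import Data.Product as Product using (_,_; proj₁; proj₂; uncurry)
open import Data.Sum as Sum using (_⊎_; inj₁; inj₂)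
open import Data.Unit using (tt)
open import Function.Base using (_∘_)
open import Function.Bundles using (mk⇔)
open import Relation.Binary.PropositionalEquality as ≡ using (_≡_; _≢_)
open import Relation.Nullary.Decidable using (yes; no; does; isYes≗does; does-⇔; dec-false; toWitness; fromWitness)

module _ where
  -- ℕ arithmetic is opened only here: further down, _+_ and _*_ are those of the field.
  open import Data.Nat using (_+_; _*_; _∸_)

  =ℕ-cong : ∀ {a b c d} → (a ≡ b ⇔ c ≡ d) → (a =ℕ b) ≡ (c =ℕ d)
  =ℕ-cong {a} {b} {c} {d} a≡b⇔c≡d = begin
    a =ℕ b              ≡⟨ isYes≗does (a ℕ.≟ b) ⟩
    does (a ℕ.≟ b)      ≡⟨ does-⇔ a≡b⇔c≡d (a ℕ.≟ b) (c ℕ.≟ d) ⟩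
    does (c ℕ.≟ d)      ≡⟨ isYes≗does (c ℕ.≟ d) ⟨
    c =ℕ d              ∎
    where open ≡.≡-Reasoning

  =ℕ-sym : ∀ a b → (a =ℕ b) ≡ (b =ℕ a)
  =ℕ-sym a b = =ℕ-cong (mk⇔ ≡.sym ≡.sym)

  =ℕ-cancel-+ˡ : ∀ c a b → ((c + a) =ℕ (c + b)) ≡ (a =ℕ b)
  =ℕ-cancel-+ˡ c a b = =ℕ-cong (mk⇔ (ℕₚ.+-cancelˡ-≡ c a b) (≡.cong (c +_)))

  toℕ+toℕ-opposite : ∀ {m} (j : Fin (suc m)) → toℕ j + toℕ (opposite j) ≡ m
  toℕ+toℕ-opposite j = ≡.trans (≡.cong (toℕ j +_) (Finₚ.opposite-prop j))
                               (ℕₚ.m+[n∸m]≡n (ℕₚ.≤-pred (Finₚ.toℕ<n j)))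

  IsEnd : ℕ → ℕ → Set
  IsEnd m a = a ≡ 0 ⊎ a ≡ m

  extreme-sum : ∀ {m a b} → a ≤ m → b ≤ m → a + b ≡ 0 ⊎ m + m ≤ a + b → IsEnd m a × IsEnd m b
  extreme-sum {a = a} _ _ (inj₁ a+b≡0) = inj₁ (ℕₚ.m+n≡0⇒m≡0 a a+b≡0) , inj₁ (ℕₚ.m+n≡0⇒n≡0 a a+b≡0)
  extreme-sum {m} {a} {b} a≤m b≤m (inj₂ m+m≤a+b) =
    inj₂ (ℕₚ.≤-antisym a≤m (ℕₚ.+-cancelʳ-≤ m m a (ℕₚ.≤-trans m+m≤a+b (ℕₚ.+-monoʳ-≤ a b≤m)))) ,
    inj₂ (ℕₚ.≤-antisym b≤m (ℕₚ.+-cancelˡ-≤ m m b (ℕₚ.≤-trans m+m≤a+b (ℕₚ.+-monoˡ-≤ b a≤m))))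

  IsEnd-opposite : ∀ {m} (j : Fin (suc m)) → IsEnd m (toℕ (opposite j)) → IsEnd m (toℕ j)
  IsEnd-opposite {m} j (inj₁ ōj≡0) = inj₂ (≡.trans (≡.sym (ℕₚ.+-identityʳ (toℕ j)))
    (≡.trans (≡.cong (toℕ j +_) (≡.sym ōj≡0)) (toℕ+toℕ-opposite j)))
  IsEnd-opposite {m} j (inj₂ ōj≡m) = inj₁ (ℕₚ.+-cancelʳ-≡ m (toℕ j) 0
    (≡.trans (≡.cong (toℕ j +_) (≡.sym ōj≡m)) (toℕ+toℕ-opposite j)))

  Extreme : ℕ → ℕ → Set
  Extreme m a = a ≡ 0 ⊎ m + m ≤ a

  inner-or-extreme : ∀ m a → (1 ≤ a × a ≤ 2 * suc m ∸ 3) ⊎ Extreme m a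
  inner-or-extreme m zero = inj₂ (inj₁ ≡.refl)
  inner-or-extreme m (suc a) with suc a ℕ.≤? 2 * suc m ∸ 3
  ... | yes a≤ = inj₁ (s≤s z≤n , a≤)
  ... | no a≰ = inj₂ (inj₂ (ℕₚ.≤-trans (m+m≤1+[2[1+m]∸3] m) (ℕₚ.≰⇒> a≰)))
    where
    m+m≤1+[2[1+m]∸3] : ∀ m → m + m ≤ suc (2 * suc m ∸ 3)
    m+m≤1+[2[1+m]∸3] zero    = z≤n
    m+m≤1+[2[1+m]∸3] (suc k) = ℕₚ.≤-reflexive (≡.cong suc (≡.sym (begin
        2 * suc (suc k) ∸ 3    ≡⟨ ≡.cong (_∸ 3) (double k) ⟩
        3 + (k + suc k) ∸ 3    ≡⟨ ℕₚ.m+n∸m≡n 3 (k + suc k) ⟩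
        k + suc k              ∎)))
      where
      open ≡.≡-Reasoning
      double : ∀ k → 2 * suc (suc k) ≡ 3 + (k + suc k)
      double = solve-∀

  ¬¬-∀Fin : ∀ n {P : Fin n → Set} → (∀ i → ¬ ¬ P i) → ¬ ¬ (∀ i → P i)
  ¬¬-∀Fin zero    _      ¬∀P = ¬∀P (λ ())
  ¬¬-∀Fin (suc n) ¬¬P ¬∀P = ¬¬P zero (λ P₀ → ¬¬-∀Fin n (¬¬P ∘ suc) (λ P₊ → ¬∀P (λ { zero → P₀ ; (suc i) → P₊ i })))

  =ℕ-false : ∀ {a b} → a ≢ b → (a =ℕ b) ≡ false
  =ℕ-false {a} {b} a≢b = ≡.trans (isYes≗does (a ℕ.≟ b)) (dec-false (a ℕ.≟ b) a≢b)

  data Direction : Set where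
    row column diagonal antidiagonal : Direction

  -- toℕ (opposite j) = n - 1 - j, so condition (c) for k is the antidiagonal with label k.
  label : ∀ {n} → Direction → Fin n → Fin n → ℕ
  label row          i j = toℕ i
  label column       i j = toℕ j
  label diagonal     i j = toℕ i + toℕ j
  label antidiagonal i j = toℕ i + toℕ (opposite j)

  label<n+n : ∀ {n} d (i j : Fin n) → label d i j < n + n
  label<n+n {n} row          i j = ℕₚ.<-≤-trans (Finₚ.toℕ<n i) (ℕₚ.m≤m+n n n)
  label<n+n {n} column       i j = ℕₚ.<-≤-trans (Finₚ.toℕ<n j) (ℕₚ.m≤m+n n n)
  label<n+n     diagonal     i j = ℕₚ.+-mono-< (Finₚ.toℕ<n i) (Finₚ.toℕ<n j)
  label<n+n     antidiagonal i j = ℕₚ.+-mono-< (Finₚ.toℕ<n i) (Finₚ.toℕ<n (opposite j))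

  antidiagonal-equation : ∀ {m a b a' b' b̄ b̄'} → b + b̄ ≡ m → b' + b̄' ≡ m →
                          (a + b' ≡ a' + b ⇔ a' + b̄' ≡ a + b̄)
  antidiagonal-equation {m} {a} {b} {a'} {b'} {b̄} {b̄'} b+b̄≡m b'+b̄'≡m = mk⇔ to from
    where
    swap₁ : ∀ x y z w → x + y + (z + w) ≡ x + z + (w + y)
    swap₁ = solve-∀
    swap₂ : ∀ x y z w → x + y + (z + w) ≡ x + w + (z + y)
    swap₂ = solve-∀
    left : a' + b̄' + (b + b') ≡ a' + b + m
    left = ≡.trans (swap₁ a' b̄' b b') (≡.cong (a' + b +_) b'+b̄'≡m)
    right : a + b̄ + (b + b') ≡ a + b' + m
    right = ≡.trans (swap₂ a b̄ b b') (≡.cong (a + b' +_) b+b̄≡m)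
    to : a + b' ≡ a' + b → a' + b̄' ≡ a + b̄
    to e = ℕₚ.+-cancelʳ-≡ (b + b') _ _
      (≡.trans left (≡.trans (≡.cong (_+ m) (≡.sym e)) (≡.sym right)))
    from : a' + b̄' ≡ a + b̄ → a + b' ≡ a' + b
    from e = ℕₚ.+-cancelʳ-≡ m _ _
      (≡.trans (≡.sym right) (≡.trans (≡.cong (_+ (b + b')) (≡.sym e)) left))

  toℕ-opposite-injective : ∀ {n} {j l : Fin n} → toℕ (opposite l) ≡ toℕ (opposite j) → toℕ l ≡ toℕ j
  toℕ-opposite-injective {j = j} {l} ōl≡ōj = ≡.cong toℕ (begin
    l                       ≡⟨ Finₚ.opposite-involutive l ⟨
    opposite (opposite l)   ≡⟨ ≡.cong opposite (Finₚ.toℕ-injective ōl≡ōj) ⟩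
    opposite (opposite j)   ≡⟨ Finₚ.opposite-involutive j ⟩
    j                       ∎)
    where open ≡.≡-Reasoning

  onLine? : ∀ {n} → Direction → (i j k l : Fin n) → Bool
  onLine? d i j k l = label d k l =ℕ label d i j

  adjacency : Bool → Bool → Bool → Bool → Bool
  adjacency r c d e = not (r ∧ c) ∧ (r ∨ c ∨ d ∨ e)

  adjacency-cong : ∀ {r r' c c' d d' e e'} → r ≡ r' → c ≡ c' → d ≡ d' → e ≡ e' →
                   adjacency r c d e ≡ adjacency r' c' d' e'
  adjacency-cong ≡.refl ≡.refl ≡.refl ≡.refl = ≡.refl

  module _ {m} (i j k l : Fin (suc m)) where

    OnLine : Direction → Set
    OnLine d = label d k l ≡ label d i j

    same-square⇒same-diagonals : OnLine row → OnLine column → OnLine diagonal × OnLine antidiagonal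
    same-square⇒same-diagonals k≡i l≡j =
      ≡.cong₂ _+_ k≡i l≡j , ≡.cong₂ _+_ k≡i (≡.cong (toℕ ∘ opposite) (Finₚ.toℕ-injective l≡j))

    diagonal-meets-line-once : OnLine row ⊎ OnLine column → OnLine diagonal ⊎ OnLine antidiagonal →
                               OnLine row × OnLine column
    diagonal-meets-line-once (inj₁ k≡i) (inj₁ d) =
      k≡i , ℕₚ.+-cancelˡ-≡ (toℕ i) _ _ (≡.trans (≡.cong (_+ toℕ l) (≡.sym k≡i)) d)
    diagonal-meets-line-once (inj₁ k≡i) (inj₂ e) =
      k≡i , toℕ-opposite-injective (ℕₚ.+-cancelˡ-≡ (toℕ i) _ _ (≡.trans (≡.cong (_+ _) (≡.sym k≡i)) e))
    diagonal-meets-line-once (inj₂ l≡j) (inj₁ d) =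
      ℕₚ.+-cancelʳ-≡ (toℕ j) _ _ (≡.trans (≡.cong (toℕ k +_) (≡.sym l≡j)) d) , l≡j
    diagonal-meets-line-once (inj₂ l≡j) (inj₂ e) =
      ℕₚ.+-cancelʳ-≡ (toℕ (opposite j)) _ _
        (≡.trans (≡.cong (λ c → toℕ k + toℕ (opposite c)) (≡.sym (Finₚ.toℕ-injective l≡j))) e) , l≡j

    diagonals-meet-once : OnLine diagonal → OnLine antidiagonal → OnLine row
    diagonals-meet-once d e = ℕₚ.*-cancelˡ-≡ (toℕ k) (toℕ i) 2 (ℕₚ.+-cancelʳ-≡ m _ _ (begin
      2 * toℕ k + m                                   ≡⟨ both-diagonals k l ⟨
      label diagonal k l + label antidiagonal k l     ≡⟨ ≡.cong₂ _+_ d e ⟩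
      label diagonal i j + label antidiagonal i j     ≡⟨ both-diagonals i j ⟩
      2 * toℕ i + m                                   ∎))
      where
      open ≡.≡-Reasoning
      regroup : ∀ x y z → x + y + (x + z) ≡ 2 * x + (y + z)
      regroup = solve-∀
      both-diagonals : ∀ (a b : Fin (suc m)) → label diagonal a b + label antidiagonal a b ≡ 2 * toℕ a + m
      both-diagonals a b = ≡.trans (regroup (toℕ a) (toℕ b) _) (≡.cong (2 * toℕ a +_) (toℕ+toℕ-opposite b))

    queensAdj≡adjacency : queensAdj i j k l ≡
      adjacency (onLine? row i j k l) (onLine? column i j k l) (onLine? diagonal i j k l) (onLine? antidiagonal i j k l)
    queensAdj≡adjacency = adjacency-cong (=ℕ-sym (toℕ i) (toℕ k)) (=ℕ-sym (toℕ j) (toℕ l))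
      (=ℕ-sym (toℕ i + toℕ j) (toℕ k + toℕ l))
      (=ℕ-cong (antidiagonal-equation {a = toℕ i} {a' = toℕ k} (toℕ+toℕ-opposite j) (toℕ+toℕ-opposite l)))

  antidiagonal-condition : ∀ {m} (k l : Fin (suc m)) a →
    ((toℕ k + suc m) =ℕ (toℕ l + a + 1)) ≡ (label antidiagonal k l =ℕ a)
  antidiagonal-condition {m} k l a = =ℕ-cong (mk⇔ to from)
    where
    regroupˡ : ∀ x y z → x + suc (y + z) ≡ x + z + suc y
    regroupˡ = solve-∀
    regroupʳ : ∀ y a → y + a + 1 ≡ a + suc y
    regroupʳ = solve-∀
    lhs : toℕ k + suc m ≡ label antidiagonal k l + suc (toℕ l)
    lhs = ≡.trans (≡.cong (λ z → toℕ k + suc z) (≡.sym (toℕ+toℕ-opposite l))) (regroupˡ (toℕ k) (toℕ l) _)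
    to : toℕ k + suc m ≡ toℕ l + a + 1 → label antidiagonal k l ≡ a
    to e = ℕₚ.+-cancelʳ-≡ (suc (toℕ l)) _ _ (≡.trans (≡.sym lhs) (≡.trans e (regroupʳ (toℕ l) a)))
    from : label antidiagonal k l ≡ a → toℕ k + suc m ≡ toℕ l + a + 1
    from e = ≡.trans lhs (≡.trans (≡.cong (_+ suc (toℕ l)) e) (≡.sym (regroupʳ (toℕ l) a)))

  extreme-diagonal : ∀ {m} (k l : Fin (suc m)) → Extreme m (label diagonal k l) →
                     IsEnd m (toℕ k) × IsEnd m (toℕ l)
  extreme-diagonal k l = extreme-sum (Finₚ.toℕ≤pred[n] k) (Finₚ.toℕ≤pred[n] l)

  extreme-antidiagonal : ∀ {m} (k l : Fin (suc m)) → Extreme m (label antidiagonal k l) →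
                         IsEnd m (toℕ k) × IsEnd m (toℕ l)
  extreme-antidiagonal k l extreme with extreme-sum (Finₚ.toℕ≤pred[n] k) (Finₚ.toℕ≤pred[n] (opposite l)) extreme
  ... | k-end , ōl-end = k-end , IsEnd-opposite l ōl-end

module _ (R : RealField) where
  open RealField R hiding (zero; _≤_)
  open RingProperties ring using (-‿+-comm; -‿distribˡ-*; -‿distribʳ-*; -‿involutive; xyx⁻¹≈y; +-inverseˡ-unique; -0#≈0#; x≈y⇒x∙y⁻¹≈ε)
  open SemiringSum semiring using (sum; sum-cong-≋; sum-cong-≗; sum-replicate-zero; ∑-distrib-+; ∑-comm; *-distribˡ-sum)
  open NaturalSolver commutativeSemiring using (solve; _:=_; _:+_; _:*_; con)
  open CommutativeSemigroupProperties *-commutativeSemigroup using (interchange)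
  open import Relation.Binary.Reasoning.Setoid setoid

  -- RealField's _≤_ has no fixity declaration.
  infix 4 _≤ᴿ_
  _≤ᴿ_ : Carrier → Carrier → Set
  _≤ᴿ_ = RealField._≤_ R

  ΣFin≡sum : ∀ n (f : Fin n → Carrier) → ΣFin R n f ≡ sum f
  ΣFin≡sum zero    f = ≡.refl
  ΣFin≡sum (suc n) f = ≡.cong (f zero +_) (ΣFin≡sum n (f ∘ suc))

  ΣFin-cong : ∀ n {f g : Fin n → Carrier} → (∀ i → f i ≈ g i) → ΣFin R n f ≈ ΣFin R n g
  ΣFin-cong n {f} {g} f≈g = begin
    ΣFin R n f  ≡⟨ ΣFin≡sum n f ⟩
    sum f       ≈⟨ sum-cong-≋ f≈g ⟩
    sum g       ≡⟨ ΣFin≡sum n g ⟨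
    ΣFin R n g  ∎

  ΣFin-zero : ∀ n {f : Fin n → Carrier} → (∀ i → f i ≈ 0#) → ΣFin R n f ≈ 0#
  ΣFin-zero n f≈0 = trans (ΣFin-cong n f≈0) (trans (reflexive (ΣFin≡sum n _)) (sum-replicate-zero n))

  ΣFin-+ : ∀ n (f g : Fin n → Carrier) → ΣFin R n (λ i → f i + g i) ≈ ΣFin R n f + ΣFin R n g
  ΣFin-+ n f g = begin
    ΣFin R n (λ i → f i + g i)  ≡⟨ ΣFin≡sum n _ ⟩
    sum (λ i → f i + g i)       ≈⟨ ∑-distrib-+ f g ⟩
    sum f + sum g               ≡⟨ ≡.cong₂ _+_ (ΣFin≡sum n f) (ΣFin≡sum n g) ⟨
    ΣFin R n f + ΣFin R n g     ∎

  ΣFin-*ˡ : ∀ n c (f : Fin n → Carrier) → c * ΣFin R n f ≈ ΣFin R n (λ i → c * f i)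
  ΣFin-*ˡ n c f = begin
    c * ΣFin R n f              ≡⟨ ≡.cong (c *_) (ΣFin≡sum n f) ⟩
    c * sum f                   ≈⟨ *-distribˡ-sum c f ⟩
    sum (λ i → c * f i)         ≡⟨ ΣFin≡sum n _ ⟨
    ΣFin R n (λ i → c * f i)    ∎

  ΣFin-comm : ∀ m n (f : Fin m → Fin n → Carrier) →
              ΣFin R m (λ i → ΣFin R n (f i)) ≈ ΣFin R n (λ j → ΣFin R m (λ i → f i j))
  ΣFin-comm m n f = begin
    ΣFin R m (λ i → ΣFin R n (f i))        ≡⟨ nested≡ m n f ⟩
    sum (λ i → sum (f i))                  ≈⟨ ∑-comm f ⟩
    sum (λ j → sum (λ i → f i j))          ≡⟨ nested≡ n m (λ j i → f i j) ⟨
    ΣFin R n (λ j → ΣFin R m (λ i → f i j)) ∎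
    where
    nested≡ : ∀ m n (g : Fin m → Fin n → Carrier) → ΣFin R m (λ i → ΣFin R n (g i)) ≡ sum (λ i → sum (g i))
    nested≡ m n g = ≡.trans (ΣFin≡sum m _) (sum-cong-≗ (λ i → ΣFin≡sum n (g i)))

  ΣFin-neg : ∀ n (f : Fin n → Carrier) → ΣFin R n (λ i → - f i) ≈ - ΣFin R n f
  ΣFin-neg zero    f = sym -0#≈0#
  ΣFin-neg (suc n) f = trans (+-congˡ (ΣFin-neg n (f ∘ suc))) (-‿+-comm (f zero) _)

  ΣFin-if : ∀ n (a : Bool) (f : Fin n → Carrier) →
            ΣFin R n (λ i → if a then f i else 0#) ≈ (if a then ΣFin R n f else 0#)
  ΣFin-if n true  f = refl
  ΣFin-if n false f = ΣFin-zero n (λ _ → refl)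

  *-if : ∀ c (b : Bool) v → c * (if b then v else 0#) ≈ (if b then v * c else 0#)
  *-if c true  v = *-comm c v
  *-if c false v = zeroʳ c

  ΣFin-select : ∀ n (t : Fin n) (f : Fin n → Carrier) →
                ΣFin R n (λ s → if toℕ s =ℕ toℕ t then f s else 0#) ≈ f t
  ΣFin-select (suc n) zero    f = trans (+-congˡ (ΣFin-zero n (λ _ → refl))) (+-identityʳ (f zero))
  ΣFin-select (suc n) (suc t) f = begin
    0# + ΣFin R n (λ s → if suc (toℕ s) =ℕ suc (toℕ t) then f (suc s) else 0#)
      ≈⟨ +-identityˡ _ ⟩
    ΣFin R n (λ s → if suc (toℕ s) =ℕ suc (toℕ t) then f (suc s) else 0#)
      ≈⟨ ΣFin-cong n (λ s → reflexive (≡.cong (if_then f (suc s) else 0#) (=ℕ-cancel-+ˡ 1 (toℕ s) (toℕ t)))) ⟩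
    ΣFin R n (λ s → if toℕ s =ℕ toℕ t then f (suc s) else 0#)
      ≈⟨ ΣFin-select n t (f ∘ suc) ⟩
    f (suc t) ∎

  ΣFin-selectℕ : ∀ K a → a < K → (g : ℕ → Carrier) →
                 ΣFin R K (λ t → if a =ℕ toℕ t then g (toℕ t) else 0#) ≈ g a
  ΣFin-selectℕ K a a<K g = begin
    ΣFin R K (λ t → if a =ℕ toℕ t then g (toℕ t) else 0#)
      ≈⟨ ΣFin-cong K (λ t → reflexive (≡.cong (if_then g (toℕ t) else 0#) (test≡ t))) ⟩
    ΣFin R K (λ t → if toℕ t =ℕ toℕ a' then g (toℕ t) else 0#)
      ≈⟨ ΣFin-select K a' (g ∘ toℕ) ⟩
    g (toℕ a')
      ≡⟨ ≡.cong g (Finₚ.toℕ-fromℕ< a<K) ⟩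
    g a ∎
    where
    a' : Fin K
    a' = fromℕ< a<K
    test≡ : ∀ t → (a =ℕ toℕ t) ≡ (toℕ t =ℕ toℕ a')
    test≡ t = ≡.trans (=ℕ-sym a (toℕ t)) (≡.cong (toℕ t =ℕ_) (≡.sym (Finₚ.toℕ-fromℕ< a<K)))

  ΣFin² : ∀ n → (Fin n → Fin n → Carrier) → Carrier
  ΣFin² n f = ΣFin R n (λ i → ΣFin R n (f i))

  ΣFin²-cong : ∀ n {f g : Fin n → Fin n → Carrier} → (∀ i j → f i j ≈ g i j) → ΣFin² n f ≈ ΣFin² n g
  ΣFin²-cong n f≈g = ΣFin-cong n (λ i → ΣFin-cong n (f≈g i))

  ΣFin²-+ : ∀ n (f g : Fin n → Fin n → Carrier) → ΣFin² n (λ i j → f i j + g i j) ≈ ΣFin² n f + ΣFin² n g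
  ΣFin²-+ n f g = trans (ΣFin-cong n (λ i → ΣFin-+ n (f i) (g i))) (ΣFin-+ n _ _)

  ΣFin²-+₄ : ∀ n (f g h k : Fin n → Fin n → Carrier) →
    ΣFin² n (λ i j → f i j + g i j + h i j + k i j) ≈ ΣFin² n f + ΣFin² n g + ΣFin² n h + ΣFin² n k
  ΣFin²-+₄ n f g h k = trans (ΣFin²-+ n _ k) (+-congʳ (trans (ΣFin²-+ n _ h) (+-congʳ (ΣFin²-+ n f g))))

  ΣFin²-*ˡ : ∀ n c (f : Fin n → Fin n → Carrier) → c * ΣFin² n f ≈ ΣFin² n (λ i j → c * f i j)
  ΣFin²-*ˡ n c f = trans (ΣFin-*ˡ n c _) (ΣFin-cong n (λ i → ΣFin-*ˡ n c (f i)))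

  ΣFin²-select : ∀ n (i j : Fin n) (f : Fin n → Fin n → Carrier) →
    ΣFin² n (λ k l → if (toℕ k =ℕ toℕ i) ∧ (toℕ l =ℕ toℕ j) then f k l else 0#) ≈ f i j
  ΣFin²-select n i j f = begin
    ΣFin² n (λ k l → if (toℕ k =ℕ toℕ i) ∧ (toℕ l =ℕ toℕ j) then f k l else 0#)
      ≈⟨ ΣFin-cong n (λ k → ΣFin-if∧ (toℕ k =ℕ toℕ i) (λ l → toℕ l =ℕ toℕ j) (f k)) ⟩
    ΣFin R n (λ k → if toℕ k =ℕ toℕ i then ΣFin R n (λ l → if toℕ l =ℕ toℕ j then f k l else 0#) else 0#)
      ≈⟨ ΣFin-select n i _ ⟩
    ΣFin R n (λ l → if toℕ l =ℕ toℕ j then f i l else 0#)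
      ≈⟨ ΣFin-select n j (f i) ⟩
    f i j ∎
    where
    ΣFin-if∧ : ∀ a (b : Fin n → Bool) (g : Fin n → Carrier) →
      ΣFin R n (λ l → if a ∧ b l then g l else 0#) ≈ (if a then ΣFin R n (λ l → if b l then g l else 0#) else 0#)
    ΣFin-if∧ true  b g = refl
    ΣFin-if∧ false b g = ΣFin-zero n (λ _ → refl)

  sumWhere-vanishing : ∀ n (c : Fin n → Fin n → Bool) (x : Vector R n) →
                       (∀ k l → T (c k l) → x k l ≈ 0#) → sumWhere R n c x ≈ 0#
  sumWhere-vanishing n c x x≈0 = ΣFin-zero n (λ k → ΣFin-zero n (λ l → vanish (c k l) (x≈0 k l)))
    where
    vanish : ∀ b {v} → (T b → v ≈ 0#) → (if b then v else 0#) ≈ 0#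
    vanish true  v≈0 = v≈0 tt
    vanish false _   = refl

  sumWhere-cong : ∀ n {c c' : Fin n → Fin n → Bool} (x : Vector R n) → (∀ k l → c k l ≡ c' k l) →
                  sumWhere R n c x ≈ sumWhere R n c' x
  sumWhere-cong n x c≡c' = ΣFin²-cong n (λ k l → reflexive (≡.cong (if_then x k l else 0#) (c≡c' k l)))

  sumWhere-− : ∀ n (c : Fin n → Fin n → Bool) (x y : Vector R n) →
               sumWhere R n c (λ i j → x i j + - y i j) ≈ sumWhere R n c x + - sumWhere R n c y
  sumWhere-− n c x y = begin
    sumWhere R n c (λ i j → x i j + - y i j)
      ≈⟨ ΣFin²-cong n (λ i j → if-− (c i j) (x i j) (y i j)) ⟩
    ΣFin² n (λ i j → (if c i j then x i j else 0#) + - (if c i j then y i j else 0#))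
      ≈⟨ ΣFin²-+ n _ (λ i j → - (if c i j then y i j else 0#)) ⟩
    sumWhere R n c x + ΣFin² n (λ i j → - (if c i j then y i j else 0#))
      ≈⟨ +-congˡ (trans (ΣFin-cong n (λ i → ΣFin-neg n _)) (ΣFin-neg n _)) ⟩
    sumWhere R n c x + - sumWhere R n c y ∎
    where
    if-− : ∀ b u v → (if b then u + - v else 0#) ≈ (if b then u else 0#) + - (if b then v else 0#)
    if-− true  u v = refl
    if-− false u v = sym (trans (+-identityˡ (- 0#)) -0#≈0#)

  sumWhere-ΣFin : ∀ n (c : Fin n → Fin n → Bool) r (x : Fin r → Vector R n) →
                  sumWhere R n c (λ i j → ΣFin R r (λ q → x q i j)) ≈ ΣFin R r (λ q → sumWhere R n c (x q))
  sumWhere-ΣFin n c r x = begin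
    sumWhere R n c (λ i j → ΣFin R r (λ q → x q i j))
      ≈⟨ ΣFin²-cong n (λ i j → ΣFin-if r (c i j) (λ q → x q i j)) ⟨
    ΣFin² n (λ i j → ΣFin R r (λ q → if c i j then x q i j else 0#))
      ≈⟨ trans (ΣFin-cong n (λ i → ΣFin-comm n r _)) (ΣFin-comm n r _) ⟩
    ΣFin R r (λ q → sumWhere R n c (x q)) ∎

  0≤-x : ∀ {x} → x ≤ᴿ 0# → 0# ≤ᴿ - x
  0≤-x {x} x≤0 = ≤-resp-≈ (-‿inverseʳ x) (+-identityˡ (- x)) (+-mono-≤ (- x) x≤0)

  -x*-x≈x*x : ∀ x → - x * - x ≈ x * x
  -x*-x≈x*x x = begin
    - x * - x      ≈⟨ -‿distribˡ-* x (- x) ⟨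
    - (x * - x)    ≈⟨ -‿cong (-‿distribʳ-* x x) ⟨
    - - (x * x)    ≈⟨ -‿involutive (x * x) ⟩
    x * x          ∎

  0≤x*x : ∀ x → 0# ≤ᴿ x * x
  0≤x*x x with ≤-total 0# x
  ... | inj₁ 0≤x = *-nonneg 0≤x 0≤x
  ... | inj₂ x≤0 = ≤-resp-≈ refl (-x*-x≈x*x x) (*-nonneg (0≤-x x≤0) (0≤-x x≤0))

  x≤x+y : ∀ {x y} → 0# ≤ᴿ y → x ≤ᴿ x + y
  x≤x+y {x} {y} 0≤y = ≤-resp-≈ (+-identityˡ x) (+-comm y x) (+-mono-≤ x 0≤y)

  +-nonneg : ∀ {x y} → 0# ≤ᴿ x → 0# ≤ᴿ y → 0# ≤ᴿ x + y
  +-nonneg 0≤x 0≤y = ≤-trans 0≤x (x≤x+y 0≤y)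

  +-nonneg-zeroˡ : ∀ {x y} → 0# ≤ᴿ x → 0# ≤ᴿ y → x + y ≈ 0# → x ≈ 0#
  +-nonneg-zeroˡ 0≤x 0≤y x+y≈0 = ≤-antisym (≤-trans (x≤x+y 0≤y) (≤-resp-≈ refl x+y≈0 ≤-refl)) 0≤x

  ΣFin-nonneg : ∀ n {f : Fin n → Carrier} → (∀ i → 0# ≤ᴿ f i) → 0# ≤ᴿ ΣFin R n f
  ΣFin-nonneg zero    _     = ≤-refl
  ΣFin-nonneg (suc n) 0≤f = +-nonneg (0≤f zero) (ΣFin-nonneg n (0≤f ∘ suc))

  ΣFin-nonneg-zero : ∀ n {f : Fin n → Carrier} → (∀ i → 0# ≤ᴿ f i) → ΣFin R n f ≈ 0# → ∀ i → f i ≈ 0#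
  ΣFin-nonneg-zero (suc n) 0≤f Σ≈0 zero    = +-nonneg-zeroˡ (0≤f zero) (ΣFin-nonneg n (0≤f ∘ suc)) Σ≈0
  ΣFin-nonneg-zero (suc n) 0≤f Σ≈0 (suc i) = ΣFin-nonneg-zero n (0≤f ∘ suc)
    (+-nonneg-zeroˡ (ΣFin-nonneg n (0≤f ∘ suc)) (0≤f zero) (trans (+-comm _ _) Σ≈0)) i

  ΣFin²-nonneg : ∀ n {f : Fin n → Fin n → Carrier} → (∀ i j → 0# ≤ᴿ f i j) → 0# ≤ᴿ ΣFin² n f
  ΣFin²-nonneg n 0≤f = ΣFin-nonneg n (λ i → ΣFin-nonneg n (0≤f i))

  x*x≈0⇒¬¬x≈0 : ∀ {x} → x * x ≈ 0# → ¬ ¬ (x ≈ 0#)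
  x*x≈0⇒¬¬x≈0 {x} x*x≈0 x≉0 with inverse x x≉0
  ... | y , x*y≈1 = 0≉1 (begin
    0#                  ≈⟨ zeroˡ (y * y) ⟨
    0# * (y * y)        ≈⟨ *-congʳ x*x≈0 ⟨
    (x * x) * (y * y)   ≈⟨ interchange x x y y ⟩
    (x * y) * (x * y)   ≈⟨ *-cong x*y≈1 x*y≈1 ⟩
    1# * 1#             ≈⟨ *-identityˡ 1# ⟩
    1#                  ∎)

  *-cancelʳ-≈0 : ∀ {a s} → ¬ s ≈ 0# → a * s ≈ 0# → a ≈ 0#
  *-cancelʳ-≈0 {a} {s} s≉0 a*s≈0 with inverse s s≉0
  ... | y , s*y≈1 = begin
    a              ≈⟨ *-identityʳ a ⟨
    a * 1#         ≈⟨ *-congˡ s*y≈1 ⟨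
    a * (s * y)    ≈⟨ *-assoc a s y ⟨
    (a * s) * y    ≈⟨ *-congʳ a*s≈0 ⟩
    0# * y         ≈⟨ zeroˡ y ⟩
    0#             ∎

  nonneg-cancelʳ : ∀ {a s} → 0# ≤ᴿ s → ¬ s ≈ 0# → 0# ≤ᴿ a * s → 0# ≤ᴿ a
  nonneg-cancelʳ {a} {s} 0≤s s≉0 0≤a*s with ≤-total 0# a
  ... | inj₁ 0≤a = 0≤a
  ... | inj₂ a≤0 = ≤-resp-≈ refl (sym a≈0) ≤-refl
    where
    a*s+-a*s≈0 : a * s + - a * s ≈ 0#
    a*s+-a*s≈0 = trans (sym (distribʳ s a (- a))) (trans (*-congʳ (-‿inverseʳ a)) (zeroˡ s))
    a≈0 : a ≈ 0#
    a≈0 = *-cancelʳ-≈0 s≉0 (+-nonneg-zeroˡ 0≤a*s (*-nonneg (0≤-x a≤0) 0≤s) a*s+-a*s≈0)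

  -x≤y : ∀ {x y} → 0# ≤ᴿ y + x → - x ≤ᴿ y
  -x≤y {x} {y} 0≤y+x = ≤-resp-≈ (+-identityˡ (- x)) (trans (+-congʳ (+-comm y x)) (xyx⁻¹≈y x y)) (+-mono-≤ (- x) 0≤y+x)

  -- r, c, d, e tell whether a square is on the row, column, diagonal, antidiagonal of a fixed square;
  -- the hypotheses say that only the fixed square itself is on two of these lines.
  adjacency-indicator : ∀ (r c d e : Bool) v →
    (T r → T c → T d × T e) → (T r ⊎ T c → T d ⊎ T e → T r × T c) → (T d → T e → T r) →
    (if adjacency r c d e then 1# else 0#) * v + (if r ∧ c then four R * v else 0#) ≈
    (if r then v else 0#) + (if c then v else 0#) + (if d then v else 0#) + (if e then v else 0#)
  adjacency-indicator true  true  true  true  v _ _ _ =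
    solve 1 (λ v → con 0 :* v :+ (con 1 :+ con 1 :+ con 1 :+ con 1) :* v := v :+ v :+ v :+ v) refl v
  adjacency-indicator true  true  true  false v rc _ _ = ⊥-elim (proj₂ (rc tt tt))
  adjacency-indicator true  true  false _     v rc _ _ = ⊥-elim (proj₁ (rc tt tt))
  adjacency-indicator true  false true  _     v _ meet _ = ⊥-elim (proj₂ (meet (inj₁ tt) (inj₁ tt)))
  adjacency-indicator true  false false true  v _ meet _ = ⊥-elim (proj₂ (meet (inj₁ tt) (inj₂ tt)))
  adjacency-indicator true  false false false v _ _ _ =
    solve 1 (λ v → con 1 :* v :+ con 0 := v :+ con 0 :+ con 0 :+ con 0) refl v
  adjacency-indicator false true  true  _     v _ meet _ = ⊥-elim (proj₁ (meet (inj₂ tt) (inj₁ tt)))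
  adjacency-indicator false true  false true  v _ meet _ = ⊥-elim (proj₁ (meet (inj₂ tt) (inj₂ tt)))
  adjacency-indicator false true  false false v _ _ _ =
    solve 1 (λ v → con 1 :* v :+ con 0 := con 0 :+ v :+ con 0 :+ con 0) refl v
  adjacency-indicator false false true  true  v _ _ de = ⊥-elim (de tt tt)
  adjacency-indicator false false true  false v _ _ _ =
    solve 1 (λ v → con 1 :* v :+ con 0 := con 0 :+ con 0 :+ v :+ con 0) refl v
  adjacency-indicator false false false true  v _ _ _ =
    solve 1 (λ v → con 1 :* v :+ con 0 := con 0 :+ con 0 :+ con 0 :+ v) refl v
  adjacency-indicator false false false false v _ _ _ =
    solve 1 (λ v → con 0 :* v :+ con 0 := con 0 :+ con 0 :+ con 0 :+ con 0) refl v

  lineSum : ∀ {n} → Vector R n → Direction → ℕ → Carrier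
  lineSum {n} x d a = sumWhere R n (λ k l → label d k l =ℕ a) x

  lineSumThrough : ∀ {n} → Vector R n → Direction → Fin n → Fin n → Carrier
  lineSumThrough x d i j = lineSum x d (label d i j)

  adjacency+4I-lineSums : ∀ {m} (x : Vector R (suc m)) (i j : Fin (suc m)) →
    _·_ R (queensMatrix R (suc m)) x i j + four R * x i j ≈
    lineSumThrough x row i j + lineSumThrough x column i j + lineSumThrough x diagonal i j + lineSumThrough x antidiagonal i j
  adjacency+4I-lineSums {m} x i j = begin
    ΣFin² n (λ k l → A k l * x k l) + four R * x i j
      ≈⟨ +-congˡ (ΣFin²-select n i j (λ k l → four R * x k l)) ⟨
    ΣFin² n (λ k l → A k l * x k l) + ΣFin² n (λ k l → if on row k l ∧ on column k l then four R * x k l else 0#)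
      ≈⟨ ΣFin²-+ n (λ k l → A k l * x k l) (λ k l → if on row k l ∧ on column k l then four R * x k l else 0#) ⟨
    ΣFin² n (λ k l → A k l * x k l + (if on row k l ∧ on column k l then four R * x k l else 0#))
      ≈⟨ ΣFin²-cong n pointwise ⟩
    ΣFin² n (λ k l → on? row k l + on? column k l + on? diagonal k l + on? antidiagonal k l)
      ≈⟨ ΣFin²-+₄ n (on? row) (on? column) (on? diagonal) (on? antidiagonal) ⟩
    lineSumThrough x row i j + lineSumThrough x column i j + lineSumThrough x diagonal i j + lineSumThrough x antidiagonal i j ∎
    where
    n : ℕ
    n = suc m
    A : Fin n → Fin n → Carrier
    A = queensMatrix R n i j
    on : Direction → Fin n → Fin n → Bool
    on d = onLine? d i j
    on? : Direction → Fin n → Fin n → Carrier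
    on? d k l = if on d k l then x k l else 0#
    pointwise : ∀ k l → A k l * x k l + (if on row k l ∧ on column k l then four R * x k l else 0#) ≈
                        on? row k l + on? column k l + on? diagonal k l + on? antidiagonal k l
    pointwise k l = trans
      (+-congʳ (*-congʳ (reflexive (≡.cong (if_then 1# else 0#) (queensAdj≡adjacency i j k l)))))
      (adjacency-indicator (on row k l) (on column k l) (on diagonal k l) (on antidiagonal k l) (x k l)
        (λ r c → Product.map fromWitness fromWitness (same-square⇒same-diagonals i j k l (toWitness r) (toWitness c)))
        (λ rc de → Product.map fromWitness fromWitness
          (diagonal-meets-line-once i j k l (Sum.map toWitness toWitness rc) (Sum.map toWitness toWitness de)))
        (λ d e → fromWitness (diagonals-meet-once i j k l (toWitness d) (toWitness e))))

  labelled-form-nonneg : ∀ {n} (x : Vector R n) (κ : Fin n → Fin n → ℕ) K → (∀ i j → κ i j < K) →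
    0# ≤ᴿ ΣFin² n (λ i j → x i j * sumWhere R n (λ k l → κ k l =ℕ κ i j) x)
  labelled-form-nonneg {n} x κ K κ<K = ≤-resp-≈ refl sum-of-squares (ΣFin-nonneg K (λ t → 0≤x*x (S (toℕ t))))
    where
    S : ℕ → Carrier
    S a = sumWhere R n (λ k l → κ k l =ℕ a) x
    sum-of-squares : ΣFin R K (λ t → S (toℕ t) * S (toℕ t)) ≈ ΣFin² n (λ i j → x i j * S (κ i j))
    sum-of-squares = begin
      ΣFin R K (λ t → S (toℕ t) * S (toℕ t))
        ≈⟨ ΣFin-cong K (λ t → trans (ΣFin²-*ˡ n _ _) (ΣFin²-cong n (λ k l → *-if _ (κ k l =ℕ toℕ t) (x k l)))) ⟩
      ΣFin R K (λ t → ΣFin² n (λ k l → if κ k l =ℕ toℕ t then x k l * S (toℕ t) else 0#))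
        ≈⟨ trans (ΣFin-comm K n _) (ΣFin-cong n (λ k → ΣFin-comm K n _)) ⟩
      ΣFin² n (λ k l → ΣFin R K (λ t → if κ k l =ℕ toℕ t then x k l * S (toℕ t) else 0#))
        ≈⟨ ΣFin²-cong n (λ k l → ΣFin-selectℕ K (κ k l) (κ<K k l) (λ a → x k l * S a)) ⟩
      ΣFin² n (λ i j → x i j * S (κ i j)) ∎

  lineForm : ∀ {n} → Vector R n → Direction → Carrier
  lineForm {n} x d = ΣFin² n (λ i j → x i j * lineSumThrough x d i j)

  lineForm-nonneg : ∀ {n} (x : Vector R n) d → 0# ≤ᴿ lineForm x d
  lineForm-nonneg {n} x d = labelled-form-nonneg x (label d) (n ℕ.+ n) (label<n+n d)

  queensMatrix+4I-nonneg : ∀ {m} (x : Vector R (suc m)) →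
    0# ≤ᴿ ΣFin² (suc m) (λ i j → x i j * (_·_ R (queensMatrix R (suc m)) x i j + four R * x i j))
  queensMatrix+4I-nonneg {m} x = ≤-resp-≈ refl (sym form≈) (+-nonneg (+-nonneg (+-nonneg
    (lineForm-nonneg x row) (lineForm-nonneg x column)) (lineForm-nonneg x diagonal)) (lineForm-nonneg x antidiagonal))
    where
    n : ℕ
    n = suc m
    line : Direction → Fin n → Fin n → Carrier
    line d i j = x i j * lineSumThrough x d i j
    distrib₄ : ∀ v a b c d → v * (a + b + c + d) ≈ v * a + v * b + v * c + v * d
    distrib₄ = solve 5 (λ v a b c d → v :* (a :+ b :+ c :+ d) := v :* a :+ v :* b :+ v :* c :+ v :* d) refl
    form≈ : ΣFin² n (λ i j → x i j * (_·_ R (queensMatrix R n) x i j + four R * x i j)) ≈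
            lineForm x row + lineForm x column + lineForm x diagonal + lineForm x antidiagonal
    form≈ = trans (ΣFin²-cong n (λ i j → trans (*-congˡ (adjacency+4I-lineSums x i j)) (distrib₄ (x i j) _ _ _ _)))
                  (ΣFin²-+₄ n (line row) (line column) (line diagonal) (line antidiagonal))

  -- x * x ≈ 0 only yields ¬ ¬ (x ≈ 0), as _≈_ need not be stable; the conclusion being a negation, that suffices.
  sumOfSquares≉0 : ∀ {n} (x : Vector R n) → ¬ IsZeroVec R x → ¬ ΣFin² n (λ i j → x i j * x i j) ≈ 0#
  sumOfSquares≉0 {n} x x≠0 Σ≈0 = ¬¬-∀Fin n (λ i → ¬¬-∀Fin n (λ j → x*x≈0⇒¬¬x≈0 (square≈0 i j))) x≠0
    where
    square≈0 : ∀ i j → x i j * x i j ≈ 0#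
    square≈0 i = ΣFin-nonneg-zero n (λ j → 0≤x*x (x i j))
      (ΣFin-nonneg-zero n (λ i → ΣFin-nonneg n (λ j → 0≤x*x (x i j))) Σ≈0 i)

  eigenvalue-bound : ∀ {n λ'} → IsEigenvalue R (queensMatrix R n) λ' → minus4 R ≤ᴿ λ'
  eigenvalue-bound {zero}    (x , x≠0 , _) = ⊥-elim (x≠0 (λ ()))
  eigenvalue-bound {suc m} {λ'} (x , x≠0 , Ax≈λ'x) = -x≤y (nonneg-cancelʳ
    (ΣFin²-nonneg n (λ i j → 0≤x*x (x i j))) (sumOfSquares≉0 x x≠0)
    (≤-resp-≈ refl (sym scaled) (queensMatrix+4I-nonneg x)))
    where
    n : ℕ
    n = suc m
    regroup : ∀ v l f → (l + f) * (v * v) ≈ v * (l * v + f * v)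
    regroup = solve 3 (λ v l f → (l :+ f) :* (v :* v) := v :* (l :* v :+ f :* v)) refl
    scaled : (λ' + four R) * ΣFin² n (λ i j → x i j * x i j) ≈
             ΣFin² n (λ i j → x i j * (_·_ R (queensMatrix R n) x i j + four R * x i j))
    scaled = trans (ΣFin²-*ˡ n (λ' + four R) (λ i j → x i j * x i j)) (ΣFin²-cong n (λ i j →
               trans (regroup (x i j) λ' (four R)) (*-congˡ (+-congʳ (sym (Ax≈λ'x i j))))))

  module _ {m} (x : Vector R (suc m)) where

    extreme-line≈0 : (∀ k l → IsEnd m (toℕ k) → IsEnd m (toℕ l) → x k l ≈ 0#) → ∀ d a → Extreme m a →
      (∀ (k l : Fin (suc m)) → Extreme m (label d k l) → IsEnd m (toℕ k) × IsEnd m (toℕ l)) → lineSum x d a ≈ 0#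
    extreme-line≈0 corners d a extreme ends = sumWhere-vanishing (suc m) (λ k l → label d k l =ℕ a) x (λ k l on-line →
      let k-end , l-end = ends k l (≡.subst (Extreme m) (≡.sym (toWitness on-line)) extreme)
      in corners k l k-end l-end)

    lineSumThrough≈0 : QueensConditions R (suc m) x → ∀ d (i j : Fin (suc m)) → lineSumThrough x d i j ≈ 0#
    lineSumThrough≈0 (rows , _)        row    i j = rows i
    lineSumThrough≈0 (_ , columns , _) column i j = columns j
    lineSumThrough≈0 (_ , _ , diagonals , _ , corners) diagonal i j with inner-or-extreme m (label diagonal i j)
    ... | inj₁ (1≤a , a≤2n-3) = diagonals _ 1≤a a≤2n-3
    ... | inj₂ extreme        = extreme-line≈0 corners diagonal _ extreme extreme-diagonal
    lineSumThrough≈0 (_ , _ , _ , antidiagonals , corners) antidiagonal i j with inner-or-extreme m (label antidiagonal i j)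
    ... | inj₁ (1≤a , a≤2n-3) =
      trans (sumWhere-cong (suc m) x (λ k l → ≡.sym (antidiagonal-condition k l (label antidiagonal i j))))
            (antidiagonals _ 1≤a a≤2n-3)
    ... | inj₂ extreme        = extreme-line≈0 corners antidiagonal _ extreme extreme-antidiagonal

    conditions⇒eigenvector : QueensConditions R (suc m) x → ∀ i j → _·_ R (queensMatrix R (suc m)) x i j ≈ minus4 R * x i j
    conditions⇒eigenvector conditions i j = trans (+-inverseˡ-unique _ _ (begin
      _·_ R (queensMatrix R (suc m)) x i j + four R * x i j
        ≈⟨ adjacency+4I-lineSums x i j ⟩
      lineSumThrough x row i j + lineSumThrough x column i j + lineSumThrough x diagonal i j + lineSumThrough x antidiagonal i j
        ≈⟨ +-cong (+-cong (+-cong (line≈0 row) (line≈0 column))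
                           (line≈0 diagonal)) (line≈0 antidiagonal) ⟩
      0# + 0# + 0# + 0#
        ≈⟨ solve 0 (con 0 :+ con 0 :+ con 0 :+ con 0 := con 0) refl ⟩
      0# ∎)) (-‿distribˡ-* (four R) (x i j))
      where
      line≈0 : ∀ d → lineSumThrough x d i j ≈ 0#
      line≈0 d = lineSumThrough≈0 conditions d i j

  pointMass : ∀ {n} → Fin n × Fin n → Vector R n
  pointMass (k , l) i j = if (toℕ i =ℕ toℕ k) ∧ (toℕ j =ℕ toℕ l) then 1# else 0#

  sumWhere-pointMass : ∀ n (c : Fin n → Fin n → Bool) (k l : Fin n) →
                       sumWhere R n c (pointMass (k , l)) ≈ (if c k l then 1# else 0#)
  sumWhere-pointMass n c k l =
    trans (ΣFin²-cong n (λ i j → reflexive (if-swap (c i j) _))) (ΣFin²-select n k l (λ i j → if c i j then 1# else 0#))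
    where
    if-swap : ∀ b b' → (if b then (if b' then 1# else 0#) else 0#) ≡ (if b' then (if b then 1# else 0#) else 0#)
    if-swap true  true  = ≡.refl
    if-swap true  false = ≡.refl
    if-swap false true  = ≡.refl
    if-swap false false = ≡.refl

  pointMass-offRow : ∀ {n} {i j k l : Fin n} → toℕ i ≢ toℕ k → pointMass (k , l) i j ≈ 0#
  pointMass-offRow {i = i} {j} {k} {l} i≢k =
    reflexive (≡.cong (λ b → if b ∧ (toℕ j =ℕ toℕ l) then 1# else 0#) (=ℕ-false i≢k))

  pointMass-offColumn : ∀ {n} {i j k l : Fin n} → toℕ j ≢ toℕ l → pointMass (k , l) i j ≈ 0#
  pointMass-offColumn {i = i} {j} {k} {l} j≢l =
    reflexive (≡.trans (≡.cong (λ b → if (toℕ i =ℕ toℕ k) ∧ b then 1# else 0#) (=ℕ-false j≢l))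
                       (≡.cong (if_then 1# else 0#) (∧-zeroʳ (toℕ i =ℕ toℕ k))))

  placementDifference : ∀ {n r} → (Fin r → Fin n × Fin n) → (Fin r → Fin n × Fin n) → Vector R n
  placementDifference {r = r} A B i j = ΣFin R r (λ q → pointMass (A q) i j) + - ΣFin R r (λ q → pointMass (B q) i j)

  sumWhere-placementDifference : ∀ n r (c : Fin n → Fin n → Bool) (A B : Fin r → Fin n × Fin n) →
    sumWhere R n c (placementDifference A B) ≈
    ΣFin R r (λ q → if uncurry c (A q) then 1# else 0#) + - ΣFin R r (λ q → if uncurry c (B q) then 1# else 0#)
  sumWhere-placementDifference n r c A B = begin
    sumWhere R n c (placementDifference A B)
      ≈⟨ sumWhere-− n c _ _ ⟩
    sumWhere R n c (λ i j → ΣFin R r (λ q → pointMass (A q) i j)) + - sumWhere R n c (λ i j → ΣFin R r (λ q → pointMass (B q) i j))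
      ≈⟨ +-cong (trans (sumWhere-ΣFin n c r _) (ΣFin-cong r (count A))) (-‿cong (trans (sumWhere-ΣFin n c r _) (ΣFin-cong r (count B)))) ⟩
    ΣFin R r (λ q → if uncurry c (A q) then 1# else 0#) + - ΣFin R r (λ q → if uncurry c (B q) then 1# else 0#) ∎
    where
    count : ∀ (P : Fin r → Fin n × Fin n) q → sumWhere R n c (pointMass (P q)) ≈ (if uncurry c (P q) then 1# else 0#)
    count P q = sumWhere-pointMass n c (proj₁ (P q)) (proj₂ (P q))

  module _ (p : ℕ) where
    private
      n : ℕ
      n = suc (suc (suc (suc p)))

    -- The two solutions of the 4-queens problem, mirror images of each other; every line of the
    -- board meets them in the same number of queens.
    queensA queensB : Fin 4 → Fin n × Fin n
    queensA zero                   = # 0 , # 1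
    queensA (suc zero)             = # 1 , # 3
    queensA (suc (suc zero))       = # 2 , # 0
    queensA (suc (suc (suc zero))) = # 3 , # 2
    queensB zero                   = # 0 , # 2
    queensB (suc zero)             = # 1 , # 0
    queensB (suc (suc zero))       = # 2 , # 3
    queensB (suc (suc (suc zero))) = # 3 , # 1

    Interior : ℕ → Set
    Interior a = a ≡ 1 ⊎ a ≡ 2

    InteriorSquare : Fin n × Fin n → Set
    InteriorSquare (k , l) = Interior (toℕ k) ⊎ Interior (toℕ l)

    queensA-interior : ∀ q → InteriorSquare (queensA q)
    queensA-interior zero                   = inj₂ (inj₁ ≡.refl)
    queensA-interior (suc zero)             = inj₁ (inj₁ ≡.refl)
    queensA-interior (suc (suc zero))       = inj₁ (inj₂ ≡.refl)
    queensA-interior (suc (suc (suc zero))) = inj₂ (inj₂ ≡.refl)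

    queensB-interior : ∀ q → InteriorSquare (queensB q)
    queensB-interior zero                   = inj₂ (inj₂ ≡.refl)
    queensB-interior (suc zero)             = inj₁ (inj₁ ≡.refl)
    queensB-interior (suc (suc zero))       = inj₁ (inj₂ ≡.refl)
    queensB-interior (suc (suc (suc zero))) = inj₂ (inj₁ ≡.refl)

    end∉interior : ∀ {a} → IsEnd (3 ℕ.+ p) a → ¬ Interior a
    end∉interior (inj₁ ≡.refl) (inj₁ ())
    end∉interior (inj₁ ≡.refl) (inj₂ ())
    end∉interior (inj₂ ≡.refl) (inj₁ ())
    end∉interior (inj₂ ≡.refl) (inj₂ ())

    off-corner : ∀ s → InteriorSquare s → ∀ {i j} → IsEnd (3 ℕ.+ p) (toℕ i) → IsEnd (3 ℕ.+ p) (toℕ j) →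
                 pointMass s i j ≈ 0#
    off-corner (k , l) (inj₁ k-interior) i-end _ =
      pointMass-offRow (λ i≡k → end∉interior i-end (≡.subst Interior (≡.sym i≡k) k-interior))
    off-corner (k , l) (inj₂ l-interior) _ j-end =
      pointMass-offColumn (λ j≡l → end∉interior j-end (≡.subst Interior (≡.sym j≡l) l-interior))

    witness : Vector R n
    witness = placementDifference queensA queensB

    witness-balanced : ∀ c → ΣFin R 4 (λ q → if uncurry c (queensA q) then 1# else 0#) ≈
                             ΣFin R 4 (λ q → if uncurry c (queensB q) then 1# else 0#) →
                       sumWhere R n c witness ≈ 0#
    witness-balanced c ΣA≈ΣB = trans (sumWhere-placementDifference n 4 c queensA queensB) (x≈y⇒x∙y⁻¹≈ε ΣA≈ΣB)

    order-3210 : ∀ a₀ a₁ a₂ a₃ → a₀ + (a₁ + (a₂ + (a₃ + 0#))) ≈ a₃ + (a₂ + (a₁ + (a₀ + 0#)))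
    order-3210 = solve 4 (λ a₀ a₁ a₂ a₃ → a₀ :+ (a₁ :+ (a₂ :+ (a₃ :+ con 0))) := a₃ :+ (a₂ :+ (a₁ :+ (a₀ :+ con 0)))) refl

    order-2031 : ∀ a₀ a₁ a₂ a₃ → a₀ + (a₁ + (a₂ + (a₃ + 0#))) ≈ a₂ + (a₀ + (a₃ + (a₁ + 0#)))
    order-2031 = solve 4 (λ a₀ a₁ a₂ a₃ → a₀ :+ (a₁ :+ (a₂ :+ (a₃ :+ con 0))) := a₂ :+ (a₀ :+ (a₃ :+ (a₁ :+ con 0)))) refl

    order-1302 : ∀ a₀ a₁ a₂ a₃ → a₀ + (a₁ + (a₂ + (a₃ + 0#))) ≈ a₁ + (a₃ + (a₀ + (a₂ + 0#)))
    order-1302 = solve 4 (λ a₀ a₁ a₂ a₃ → a₀ :+ (a₁ :+ (a₂ :+ (a₃ :+ con 0))) := a₁ :+ (a₃ :+ (a₀ :+ (a₂ :+ con 0)))) refl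

    witness-rows : ∀ (k : Fin n) → sumWhere R n (λ i j → toℕ i =ℕ toℕ k) witness ≈ 0#
    witness-rows k = witness-balanced (λ i j → toℕ i =ℕ toℕ k) refl

    witness-columns : ∀ (k : Fin n) → sumWhere R n (λ i j → toℕ j =ℕ toℕ k) witness ≈ 0#
    witness-columns k = witness-balanced (λ i j → toℕ j =ℕ toℕ k) (order-3210 _ _ _ _)

    witness-diagonals : ∀ k → sumWhere R n (λ i j → (toℕ i ℕ.+ toℕ j) =ℕ k) witness ≈ 0#
    witness-diagonals k = witness-balanced (λ i j → (toℕ i ℕ.+ toℕ j) =ℕ k) (order-2031 _ _ _ _)

    -- Partners lie on a common antidiagonal, one or two squares apart along it.
    witness-antidiagonals : ∀ k → sumWhere R n (λ i j → (toℕ i ℕ.+ n) =ℕ (toℕ j ℕ.+ k ℕ.+ 1)) witness ≈ 0#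
    witness-antidiagonals k = witness-balanced (λ i j → (toℕ i ℕ.+ n) =ℕ (toℕ j ℕ.+ k ℕ.+ 1)) (trans (order-1302 _ _ _ _)
      (+-cong (shift 1 n (2 ℕ.+ k ℕ.+ 1)) (+-cong (shift 2 (1 ℕ.+ n) (0 ℕ.+ k ℕ.+ 1))
        (+-cong (sym (shift 2 n (1 ℕ.+ k ℕ.+ 1))) (+-congʳ (sym (shift 1 (2 ℕ.+ n) (0 ℕ.+ k ℕ.+ 1))))))))
      where
      shift : ∀ s a b → (if (s ℕ.+ a) =ℕ (s ℕ.+ b) then 1# else 0#) ≈ (if a =ℕ b then 1# else 0#)
      shift s a b = reflexive (≡.cong (if_then 1# else 0#) (=ℕ-cancel-+ˡ s a b))

    witness-corners : ∀ i j → IsEnd (3 ℕ.+ p) (toℕ i) → IsEnd (3 ℕ.+ p) (toℕ j) → witness i j ≈ 0#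
    witness-corners i j i-end j-end = x≈y⇒x∙y⁻¹≈ε (trans
      (ΣFin-zero 4 (λ q → off-corner (queensA q) (queensA-interior q) i-end j-end))
      (sym (ΣFin-zero 4 (λ q → off-corner (queensB q) (queensB-interior q) i-end j-end))))

    witness-conditions : QueensConditions R n witness
    witness-conditions = witness-rows , witness-columns , (λ k _ _ → witness-diagonals k) ,
                         (λ k _ _ → witness-antidiagonals k) , witness-corners

    witness-nonzero : ¬ IsZeroVec R witness
    witness-nonzero witness≈0 = 0≉1 (begin
      0#                                          ≈⟨ witness≈0 (# 0) (# 1) ⟨
      (1# + ΣFin R 3 (λ _ → 0#)) + - ΣFin R 4 (λ _ → 0#)
        ≈⟨ +-cong (+-congˡ (ΣFin-zero 3 (λ _ → refl))) (-‿cong (ΣFin-zero 4 (λ _ → refl))) ⟩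
      (1# + 0#) + - 0#                            ≈⟨ +-cong (+-identityʳ 1#) -0#≈0# ⟩
      1# + 0#                                     ≈⟨ +-identityʳ 1# ⟩
      1#                                          ∎)

theorem4p1 : (R : RealField) → (n : ℕ) → 4 ≤ n →
    (IsEigenvalue R (queensMatrix R n) (minus4 R)
      ⇔ ∃ (λ (x : Vector R n) → ¬ IsZeroVec R x × QueensConditions R n x))
    × (IsEigenvalue R (queensMatrix R n) (minus4 R) →
        ∀ (x : Vector R n) → ¬ IsZeroVec R x → QueensConditions R n x →
        IsEigenvector R (queensMatrix R n) (minus4 R) x)
    × IsLeastEigenvalue R (queensMatrix R n) (minus4 R)
theorem4p1 R (suc (suc (suc (suc p)))) (s≤s (s≤s (s≤s (s≤s z≤n)))) =
  mk⇔ (λ _ → witness R p , witness-nonzero R p , witness-conditions R p)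
      (λ (x , x≠0 , conditions) → x , x≠0 , conditions⇒eigenvector R x conditions) ,
  (λ _ x x≠0 conditions → x≠0 , conditions⇒eigenvector R x conditions) ,
  (witness R p , witness-nonzero R p , conditions⇒eigenvector R (witness R p) (witness-conditions R p)) ,
  (λ _ → eigenvalue-bound R)
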